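{- Let $\beta=\frac{1+\sqrt5}2$. Every word in $\{ -1,0,1\}^*$ that contains a factor belonging to $H$ is $\beta$-heavy, where (writing $\bar1$ for the digit $-1$) $$H = 1(0100)^*1\ \cup\ 1(0100)^*0101\ \cup\ 1(00\bar10)^*\bar1\ \cup\ 1(00\bar10)^*0\bar1\ \cup\ \bar1(0\bar100)^*\bar1\ \cup\ \bar1(0\bar100)^*0\bar10\bar1\ \cup\ \bar1(0010)^*1\ \cup\ \bar1(0010)^*01.$$
   Context: For a finite word $x=x_1\cdots x_n$ over $\mathbb Z$, write $.x_1\cdots x_n=\sum_{j=1}^n x_j\beta^{ -j}$ and $\|x\|=\sum_{j=1}^n|x_j|$. For $x,y\in\mathbb Z^*$, $x\sim_\beta y$ means $.x=\beta^k\cdot .y$ for some $k\in\mathbb Z$. A word $x$ is $\beta$-heavy if there is $y\in\mathbb Z^*$ with $x\sim_\beta y$ and $\|y\|<\|x\|$. A factor of a word is a contiguous subword; $u^*$ denotes the set of finite concatenations of copies of $u$ (including the empty word). -}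

module Defs where

open import Data.Integer using (ℤ; +_; -[1+_]; _+_; _*_; -_; ∣_∣; 0ℤ; 1ℤ)
open import Data.Nat using (ℕ; zero; suc) renaming (_+_ to _+ℕ_; _<_ to _<ℕ_)
open import Data.List using (List; []; _∷_; _++_; concat; replicate)
open import Data.List.Relation.Unary.All using (All)
open import Data.Product using (_×_; _,_; ∃; Σ)
open import Data.Sum using (_⊎_)
open import Relation.Binary.PropositionalEquality using (_≡_)

-- A pair (a , b) denotes
-- the real number a + bβ.  Since 1 and β are linearly independent over ℚ,
-- equality of real numbers in ℤ[β] is exactly equality of pairs.
Zβ : Set
Zβ = ℤ × ℤ

0β : Zβ
0β = (0ℤ , 0ℤ)

1β : Zβ
1β = (1ℤ , 0ℤ)

ι : ℤ → Zβ
ι a = (a , 0ℤ)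

_+β_ : Zβ → Zβ → Zβ
(a , b) +β (c , d) = (a + c , b + d)

-- (a + bβ)(c + dβ) = ac + (ad + bc)β + bdβ² and β² = β + 1
_*β_ : Zβ → Zβ → Zβ
(a , b) *β (c , d) = (a * c + b * d , a * d + b * c + b * d)

-- β itself and β⁻¹ = β - 1
β : Zβ
β = (0ℤ , 1ℤ)

β⁻¹ : Zβ
β⁻¹ = (- 1ℤ , 1ℤ)

powβ : Zβ → ℕ → Zβ
powβ x zero = 1β
powβ x (suc n) = x *β powβ x n

βpow : ℤ → Zβ
βpow (+ n) = powβ β n
βpow -[1+ n ] = powβ β⁻¹ (suc n)

-- .x₁⋯xₙ = Σ xⱼ β^{-j}, computed as .(d w) = β⁻¹ (d + .w)
val : List ℤ → Zβ
val [] = 0β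
val (d ∷ w) = β⁻¹ *β (ι d +β val w)

norm : List ℤ → ℕ
norm [] = 0
norm (d ∷ w) = ∣ d ∣ +ℕ norm w

_∼β_ : List ℤ → List ℤ → Set
x ∼β y = ∃ λ (k : ℤ) → val x ≡ βpow k *β val y

Heavy : List ℤ → Set
Heavy x = Σ (List ℤ) λ y → (x ∼β y) × (norm y <ℕ norm x)

IsDigit : ℤ → Set
IsDigit d = (d ≡ + 1) ⊎ (d ≡ + 0) ⊎ (d ≡ -[1+ 0 ])

Factor : List ℤ → List ℤ → Set
Factor f x = Σ (List ℤ) λ u → Σ (List ℤ) λ v → x ≡ u ++ f ++ v

rep : ℕ → List ℤ → List ℤ
rep n u = concat (replicate n u)

private
  o z m : ℤ
  o = + 1
  z = + 0
  m = -[1+ 0 ]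

data InH : List ℤ → Set where
  h1 : ∀ n → InH (o ∷ rep n (z ∷ o ∷ z ∷ z ∷ []) ++ o ∷ [])
  h2 : ∀ n → InH (o ∷ rep n (z ∷ o ∷ z ∷ z ∷ []) ++ z ∷ o ∷ z ∷ o ∷ [])
  h3 : ∀ n → InH (o ∷ rep n (z ∷ z ∷ m ∷ z ∷ []) ++ m ∷ [])
  h4 : ∀ n → InH (o ∷ rep n (z ∷ z ∷ m ∷ z ∷ []) ++ z ∷ m ∷ [])
  h5 : ∀ n → InH (m ∷ rep n (z ∷ m ∷ z ∷ z ∷ []) ++ m ∷ [])
  h6 : ∀ n → InH (m ∷ rep n (z ∷ m ∷ z ∷ z ∷ []) ++ z ∷ m ∷ z ∷ m ∷ [])
  h7 : ∀ n → InH (m ∷ rep n (z ∷ z ∷ o ∷ z ∷ []) ++ o ∷ [])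
  h8 : ∀ n → InH (m ∷ rep n (z ∷ z ∷ o ∷ z ∷ []) ++ z ∷ o ∷ [])

-- The word 1 1̄ 1̄ has value β⁻¹ − β⁻² − β⁻³ = 0, and so do suitable longer words built
-- from it.  For every f ∈ H there is a zero-valued word d·m·l with m as long as f such
-- that adding it digitwise to 0·x·0, m lying under f, lowers the norm: d and l cost at
-- most |d| + |l| on the two neighbours of f, while m saves more than that inside f.
-- The sum has the value of 0·x·0, which is β⁻¹·.x, so x is heavy.  For the eight
-- families of H the zero words are periodic in the same way as f (for instance
-- (0100)ⁿ lies over (0 1̄ 0 1̄)ⁿ), and pumping a period keeps the value zero because
-- prefixing the period to the tail of the zero word does not change the tail's value.
module Submission where

open import Defs
open import Data.Integer using (ℤ)
open import Data.List using (List)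
open import Data.List.Relation.Unary.All using (All)
open import Data.Product using (Σ; _×_)

import Algebra.Properties.CommutativeSemigroup as CommSemigroupProps
open import Data.Integer using (-_; ∣_∣; 0ℤ; 1ℤ; -1ℤ)
  renaming (_+_ to _+ℤ_; _*_ to _*ℤ_)
import Data.Integer.Properties as ℤ
open import Data.Integer.Tactic.RingSolver using (solve-∀)
open import Data.Nat using (zero; suc; _+_; _≤_; _<_; _≤?_; _<?_)
import Data.Nat.Properties as ℕ
import Data.Nat.Tactic.RingSolver as ℕ-Solver
open import Data.List using ([]; _∷_; _++_; _∷ʳ_; length)
import Data.List.Properties as List
open import Data.Product using (_,_)
open import Data.Product.Properties using (≡-dec)
open import Relation.Binary.Definitions using (DecidableEquality)
open import Relation.Nullary.Decidable using (True; toWitness)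
open import Relation.Binary.PropositionalEquality

open CommSemigroupProps ℕ.+-commutativeSemigroup using (x∙yz≈y∙xz; xy∙z≈x∙zy)

+β-identityˡ : ∀ x → 0β +β x ≡ x
+β-identityˡ (a , b) = cong₂ _,_ (ℤ.+-identityˡ a) (ℤ.+-identityˡ b)

+β-identityʳ : ∀ x → x +β 0β ≡ x
+β-identityʳ (a , b) = cong₂ _,_ (ℤ.+-identityʳ a) (ℤ.+-identityʳ b)

+β-interchange : ∀ w x y z → (w +β x) +β (y +β z) ≡ (w +β y) +β (x +β z)
+β-interchange (a , a′) (b , b′) (c , c′) (d , d′) =
  cong₂ _,_ (interchange a b c d) (interchange a′ b′ c′ d′)
  where open CommSemigroupProps ℤ.+-commutativeSemigroup using (interchange)

*β-distribˡ-+β : ∀ x y z → x *β (y +β z) ≡ (x *β y) +β (x *β z)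
*β-distribˡ-+β (p , q) (a , b) (c , d) = cong₂ _,_ (first p q a b c d) (second p q a b c d)
  where
  first : ∀ p q a b c d →
          p *ℤ (a +ℤ c) +ℤ q *ℤ (b +ℤ d) ≡ (p *ℤ a +ℤ q *ℤ b) +ℤ (p *ℤ c +ℤ q *ℤ d)
  first = solve-∀
  second : ∀ p q a b c d →
           p *ℤ (b +ℤ d) +ℤ q *ℤ (a +ℤ c) +ℤ q *ℤ (b +ℤ d)
             ≡ (p *ℤ b +ℤ q *ℤ a +ℤ q *ℤ b) +ℤ (p *ℤ d +ℤ q *ℤ c +ℤ q *ℤ d)
  second = solve-∀

β*[β⁻¹*x]≡x : ∀ x → β *β (β⁻¹ *β x) ≡ x
β*[β⁻¹*x]≡x (a , b) = cong₂ _,_ (first a b) (second a b)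
  where
  first : ∀ a b → 0ℤ *ℤ (- 1ℤ *ℤ a +ℤ 1ℤ *ℤ b) +ℤ 1ℤ *ℤ (- 1ℤ *ℤ b +ℤ 1ℤ *ℤ a +ℤ 1ℤ *ℤ b) ≡ a
  first = solve-∀
  second : ∀ a b → 0ℤ *ℤ (- 1ℤ *ℤ b +ℤ 1ℤ *ℤ a +ℤ 1ℤ *ℤ b) +ℤ 1ℤ *ℤ (- 1ℤ *ℤ a +ℤ 1ℤ *ℤ b)
                     +ℤ 1ℤ *ℤ (- 1ℤ *ℤ b +ℤ 1ℤ *ℤ a +ℤ 1ℤ *ℤ b) ≡ b
  second = solve-∀

_≟β_ : DecidableEquality Zβ
_≟β_ = ≡-dec ℤ._≟_ ℤ._≟_

infixl 6 _⊕_
_⊕_ : List ℤ → List ℤ → List ℤ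
[] ⊕ t = t
(d ∷ s) ⊕ [] = d ∷ s
(d ∷ s) ⊕ (e ∷ t) = (d +ℤ e) ∷ (s ⊕ t)

⊕-identityʳ : ∀ s → s ⊕ [] ≡ s
⊕-identityʳ [] = refl
⊕-identityʳ (d ∷ s) = refl

++-⊕-++ : ∀ a b {x y} → length a ≡ length b → (a ++ x) ⊕ (b ++ y) ≡ (a ⊕ b) ++ (x ⊕ y)
++-⊕-++ [] [] eq = refl
++-⊕-++ (d ∷ a) (e ∷ b) eq = cong ((d +ℤ e) ∷_) (++-⊕-++ a b (ℕ.suc-injective eq))

length-++-cong : ∀ (a a′ : List ℤ) {b b′ : List ℤ} → length a ≡ length a′ → length b ≡ length b′ →
                 length (a ++ b) ≡ length (a′ ++ b′)
length-++-cong a a′ eqa eqb =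
  trans (List.length-++ a) (trans (cong₂ _+_ eqa eqb) (sym (List.length-++ a′)))

length-rep-cong : ∀ {q q′ : List ℤ} → length q′ ≡ length q → ∀ n → length (rep n q′) ≡ length (rep n q)
length-rep-cong eq zero = refl
length-rep-cong {q} {q′} eq (suc n) = length-++-cong q′ q eq (length-rep-cong eq n)

norm-++ : ∀ a b → norm (a ++ b) ≡ norm a + norm b
norm-++ [] b = refl
norm-++ (d ∷ a) b = trans (cong (∣ d ∣ +_) (norm-++ a b)) (sym (ℕ.+-assoc ∣ d ∣ (norm a) (norm b)))

norm-++-++ : ∀ a b c → norm (a ++ b ++ c) ≡ norm a + (norm b + norm c)
norm-++-++ a b c = trans (norm-++ a (b ++ c)) (cong (norm a +_) (norm-++ b c))

norm-rep-⊕-≤ : ∀ {q q′} → length q ≡ length q′ → norm (q ⊕ q′) ≤ norm q →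
               ∀ n → norm (rep n q ⊕ rep n q′) ≤ norm (rep n q)
norm-rep-⊕-≤ eq le zero = ℕ.≤-refl
norm-rep-⊕-≤ {q} {q′} eq le (suc n) = begin
  norm ((q ++ rep n q) ⊕ (q′ ++ rep n q′))    ≡⟨ cong norm (++-⊕-++ q q′ eq) ⟩
  norm ((q ⊕ q′) ++ (rep n q ⊕ rep n q′))     ≡⟨ norm-++ (q ⊕ q′) _ ⟩
  norm (q ⊕ q′) + norm (rep n q ⊕ rep n q′)   ≤⟨ ℕ.+-mono-≤ le (norm-rep-⊕-≤ eq le n) ⟩
  norm q + norm (rep n q)                     ≡⟨ norm-++ q (rep n q) ⟨
  norm (q ++ rep n q)                         ∎
  where open ℕ.≤-Reasoning

val-++-cong : ∀ p {t t′} → val t ≡ val t′ → val (p ++ t) ≡ val (p ++ t′)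
val-++-cong [] eq = eq
val-++-cong (d ∷ p) eq = cong (λ w → β⁻¹ *β (ι d +β w)) (val-++-cong p eq)

val-rep-++ : ∀ q {t} → val (q ++ t) ≡ val t → ∀ n → val (rep n q ++ t) ≡ val t
val-rep-++ q eq zero = refl
val-rep-++ q {t} eq (suc n) = begin
  val ((q ++ rep n q) ++ t)  ≡⟨ cong val (List.++-assoc q (rep n q) t) ⟩
  val (q ++ rep n q ++ t)    ≡⟨ val-++-cong q (val-rep-++ q eq n) ⟩
  val (q ++ t)               ≡⟨ eq ⟩
  val t                      ∎
  where open ≡-Reasoning

val-⊕ : ∀ s t → val (s ⊕ t) ≡ val s +β val t
val-⊕ [] t = sym (+β-identityˡ (val t))
val-⊕ (d ∷ s) [] = sym (+β-identityʳ (val (d ∷ s)))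
val-⊕ (d ∷ s) (e ∷ t) = begin
  β⁻¹ *β (ι (d +ℤ e) +β val (s ⊕ t))             ≡⟨ cong (λ w → β⁻¹ *β (ι (d +ℤ e) +β w)) (val-⊕ s t) ⟩
  β⁻¹ *β ((ι d +β ι e) +β (val s +β val t))      ≡⟨ cong (β⁻¹ *β_) (+β-interchange (ι d) (ι e) (val s) (val t)) ⟩
  β⁻¹ *β ((ι d +β val s) +β (ι e +β val t))      ≡⟨ *β-distribˡ-+β β⁻¹ (ι d +β val s) (ι e +β val t) ⟩
  val (d ∷ s) +β val (e ∷ t)                     ∎
  where open ≡-Reasoning

val-⊕-zero : ∀ s {D} → val D ≡ 0β → val (s ⊕ D) ≡ val s
val-⊕-zero s {D} D≡0 = trans (val-⊕ s D) (trans (cong (val s +β_) D≡0) (+β-identityʳ (val s)))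

val-pad : ∀ x → val x ≡ β *β val (0ℤ ∷ x ∷ʳ 0ℤ)
val-pad x = begin
  val x                               ≡⟨ β*[β⁻¹*x]≡x (val x) ⟨
  β *β (β⁻¹ *β val x)                 ≡⟨ cong (λ w → β *β (β⁻¹ *β w)) (+β-identityˡ (val x)) ⟨
  β *β (β⁻¹ *β (ι 0ℤ +β val x))       ≡⟨ cong (λ t → β *β (β⁻¹ *β (ι 0ℤ +β val t))) (List.++-identityʳ x) ⟨
  β *β (β⁻¹ *β (ι 0ℤ +β val (x ++ []))) ≡⟨ cong (λ w → β *β (β⁻¹ *β (ι 0ℤ +β w))) (val-++-cong x refl) ⟨
  β *β val (0ℤ ∷ x ∷ʳ 0ℤ)             ∎
  where open ≡-Reasoning

norm-pad : ∀ x → norm (0ℤ ∷ x ∷ʳ 0ℤ) ≡ norm x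
norm-pad x = trans (norm-++ x (0ℤ ∷ [])) (ℕ.+-identityʳ (norm x))

val-replace : ∀ p w s {D} → val D ≡ 0β → length D ≡ length w →
              val (p ++ (w ⊕ D) ++ s) ≡ val (p ++ w ++ s)
val-replace p w s {D} D≡0 len = val-++-cong p (begin
  val ((w ⊕ D) ++ s)          ≡⟨ cong (λ t → val ((w ⊕ D) ++ t)) (⊕-identityʳ s) ⟨
  val ((w ⊕ D) ++ (s ⊕ []))   ≡⟨ cong val (++-⊕-++ w D (sym len)) ⟨
  val ((w ++ s) ⊕ (D ++ []))  ≡⟨ cong (λ t → val ((w ++ s) ⊕ t)) (List.++-identityʳ D) ⟩
  val ((w ++ s) ⊕ D)          ≡⟨ val-⊕-zero (w ++ s) D≡0 ⟩
  val (w ++ s)                ∎)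
  where open ≡-Reasoning

norm-replace : ∀ p {w w′} s → norm w′ < norm w → norm (p ++ w′ ++ s) < norm (p ++ w ++ s)
norm-replace p {w} {w′} s lt = begin-strict
  norm (p ++ w′ ++ s)           ≡⟨ norm-++-++ p w′ s ⟩
  norm p + (norm w′ + norm s)   <⟨ ℕ.+-monoʳ-< (norm p) (ℕ.+-monoˡ-< (norm s) lt) ⟩
  norm p + (norm w + norm s)    ≡⟨ norm-++-++ p w s ⟨
  norm (p ++ w ++ s)            ∎
  where open ℕ.≤-Reasoning

∷ʳ-uncons : ∀ (v : List ℤ) c → Σ ℤ λ b → Σ (List ℤ) λ s → v ∷ʳ c ≡ b ∷ s
∷ʳ-uncons [] c = c , [] , refl
∷ʳ-uncons (b ∷ v) c = b , v ∷ʳ c , refl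

factor-with-neighbours : ∀ c u f v c′ → Σ (List ℤ) λ p → Σ ℤ λ a → Σ ℤ λ b → Σ (List ℤ) λ s →
                         c ∷ (u ++ f ++ v) ∷ʳ c′ ≡ p ++ (a ∷ f ∷ʳ b) ++ s
factor-with-neighbours c [] f v c′ with ∷ʳ-uncons v c′
... | b , s , eq = [] , c , b , s , cong (c ∷_) (begin
  (f ++ v) ∷ʳ c′       ≡⟨ List.++-assoc f v (c′ ∷ []) ⟩
  f ++ v ∷ʳ c′         ≡⟨ cong (f ++_) eq ⟩
  f ++ b ∷ s           ≡⟨ List.++-assoc f (b ∷ []) s ⟨
  (f ∷ʳ b) ++ s        ∎)
  where open ≡-Reasoning
factor-with-neighbours c (d ∷ u) f v c′ with factor-with-neighbours d u f v c′
... | p , a , b , s , eq = c ∷ p , a , b , s , cong (c ∷_) eq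

-- first·middle·last is to be added digitwise to a·f·b, middle lying under f,
-- for arbitrary neighbours a and b of f.
record Cancels (f : List ℤ) (first : ℤ) (middle : List ℤ) (last : ℤ) : Set where
  constructor cancels
  field
    val-zero  : val (first ∷ middle ∷ʳ last) ≡ 0β
    length-eq : length middle ≡ length f
    norm-drop : ∣ first ∣ + ∣ last ∣ + norm (f ⊕ middle) < norm f

norm-∷-∷ʳ : ∀ a f b → norm (a ∷ f ∷ʳ b) ≡ ∣ a ∣ + (norm f + ∣ b ∣)
norm-∷-∷ʳ a f b = cong (∣ a ∣ +_) (trans (norm-++ f (b ∷ [])) (cong (norm f +_) (ℕ.+-identityʳ ∣ b ∣)))

cancels-neighbours : ∀ {f d M l} → Cancels f d M l →
                     ∀ a b → norm ((a ∷ f ∷ʳ b) ⊕ (d ∷ M ∷ʳ l)) < norm (a ∷ f ∷ʳ b)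
cancels-neighbours {f} {d} {M} {l} c a b = begin-strict
  norm ((a ∷ f ∷ʳ b) ⊕ (d ∷ M ∷ʳ l))                 ≡⟨ cong (λ t → norm ((a +ℤ d) ∷ t)) (++-⊕-++ f M (sym length-eq)) ⟩
  norm ((a +ℤ d) ∷ (f ⊕ M) ∷ʳ (b +ℤ l))               ≡⟨ norm-∷-∷ʳ (a +ℤ d) (f ⊕ M) (b +ℤ l) ⟩
  ∣ a +ℤ d ∣ + (norm (f ⊕ M) + ∣ b +ℤ l ∣)            ≤⟨ ℕ.+-mono-≤ (ℤ.∣i+j∣≤∣i∣+∣j∣ a d) (ℕ.+-monoʳ-≤ (norm (f ⊕ M)) (ℤ.∣i+j∣≤∣i∣+∣j∣ b l)) ⟩
  (∣ a ∣ + ∣ d ∣) + (norm (f ⊕ M) + (∣ b ∣ + ∣ l ∣))  ≡⟨ regroup (∣ a ∣) (∣ b ∣) (∣ d ∣) (∣ l ∣) (norm (f ⊕ M)) ⟩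
  (∣ a ∣ + ∣ b ∣) + (∣ d ∣ + ∣ l ∣ + norm (f ⊕ M))    <⟨ ℕ.+-monoʳ-< (∣ a ∣ + ∣ b ∣) norm-drop ⟩
  (∣ a ∣ + ∣ b ∣) + norm f                            ≡⟨ xy∙z≈x∙zy (∣ a ∣) (∣ b ∣) (norm f) ⟩
  ∣ a ∣ + (norm f + ∣ b ∣)                            ≡⟨ norm-∷-∷ʳ a f b ⟨
  norm (a ∷ f ∷ʳ b)                                  ∎
  where
  open Cancels c
  open ℕ.≤-Reasoning
  regroup : ∀ a b d l m → (a + d) + (m + (b + l)) ≡ (a + b) + (d + l + m)
  regroup = ℕ-Solver.solve-∀

cancels⇒heavy : ∀ {f d M l} → Cancels f d M l → ∀ u v → Heavy (u ++ f ++ v)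
cancels⇒heavy {f} {d} {M} {l} c u v with factor-with-neighbours 0ℤ u f v 0ℤ
... | p , a , b , s , split = p ++ (w ⊕ D) ++ s , (1ℤ , same-value) , smaller-norm
  where
  open Cancels c
  x = u ++ f ++ v
  w = a ∷ f ∷ʳ b
  D = d ∷ M ∷ʳ l
  same-value : val x ≡ βpow 1ℤ *β val (p ++ (w ⊕ D) ++ s)
  same-value = begin
    val x                           ≡⟨ val-pad x ⟩
    β *β val (0ℤ ∷ x ∷ʳ 0ℤ)         ≡⟨ cong (λ t → β *β val t) split ⟩
    β *β val (p ++ w ++ s)          ≡⟨ cong (β *β_) (val-replace p w s val-zero (cong suc (length-++-cong M f length-eq refl))) ⟨
    β *β val (p ++ (w ⊕ D) ++ s)    ∎
    where open ≡-Reasoning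
  smaller-norm : norm (p ++ (w ⊕ D) ++ s) < norm x
  smaller-norm = begin-strict
    norm (p ++ (w ⊕ D) ++ s)   <⟨ norm-replace p s (cancels-neighbours c a b) ⟩
    norm (p ++ w ++ s)         ≡⟨ cong norm split ⟨
    norm (0ℤ ∷ x ∷ʳ 0ℤ)        ≡⟨ norm-pad x ⟩
    norm x                     ∎
    where open ℕ.≤-Reasoning

cancels-insert : ∀ p p′ r r′ s s′ {d l} →
                 length p′ ≡ length p → length r′ ≡ length r → length s′ ≡ length s →
                 val (r′ ++ s′ ∷ʳ l) ≡ val (s′ ∷ʳ l) → norm (r ⊕ r′) ≤ norm r →
                 Cancels (p ++ s) d (p′ ++ s′) l → Cancels (p ++ r ++ s) d (p′ ++ r′ ++ s′) l
cancels-insert p p′ r r′ s s′ {d} {l} lp lr ls period light c =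
  cancels zero-value (length-++-cong p′ p lp (length-++-cong r′ r lr ls)) smaller-norm
  where
  open Cancels c
  zero-value : val (d ∷ (p′ ++ r′ ++ s′) ∷ʳ l) ≡ 0β
  zero-value = begin
    val (d ∷ (p′ ++ r′ ++ s′) ∷ʳ l)  ≡⟨ cong (λ t → val (d ∷ t)) (List.++-assoc p′ (r′ ++ s′) (l ∷ [])) ⟩
    val (d ∷ p′ ++ (r′ ++ s′) ∷ʳ l)  ≡⟨ cong (λ t → val (d ∷ p′ ++ t)) (List.++-assoc r′ s′ (l ∷ [])) ⟩
    val ((d ∷ p′) ++ r′ ++ s′ ∷ʳ l)  ≡⟨ val-++-cong (d ∷ p′) period ⟩
    val ((d ∷ p′) ++ s′ ∷ʳ l)        ≡⟨ cong (λ t → val (d ∷ t)) (List.++-assoc p′ s′ (l ∷ [])) ⟨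
    val (d ∷ (p′ ++ s′) ∷ʳ l)        ≡⟨ val-zero ⟩
    0β                               ∎
    where open ≡-Reasoning
  open ℕ.≤-Reasoning
  k = ∣ d ∣ + ∣ l ∣
  base-drop : k + (norm (p ⊕ p′) + norm (s ⊕ s′)) < norm p + norm s
  base-drop = begin-strict
    k + (norm (p ⊕ p′) + norm (s ⊕ s′))  ≡⟨ cong (k +_) (norm-++ (p ⊕ p′) (s ⊕ s′)) ⟨
    k + norm ((p ⊕ p′) ++ (s ⊕ s′))      ≡⟨ cong (λ t → k + norm t) (++-⊕-++ p p′ (sym lp)) ⟨
    k + norm ((p ++ s) ⊕ (p′ ++ s′))     <⟨ norm-drop ⟩
    norm (p ++ s)                        ≡⟨ norm-++ p s ⟩
    norm p + norm s                      ∎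
  smaller-norm : k + norm ((p ++ r ++ s) ⊕ (p′ ++ r′ ++ s′)) < norm (p ++ r ++ s)
  smaller-norm = begin-strict
    k + norm ((p ++ r ++ s) ⊕ (p′ ++ r′ ++ s′))              ≡⟨ cong (λ t → k + norm t) (++-⊕-++ p p′ (sym lp)) ⟩
    k + norm ((p ⊕ p′) ++ (r ++ s) ⊕ (r′ ++ s′))             ≡⟨ cong (λ t → k + norm ((p ⊕ p′) ++ t)) (++-⊕-++ r r′ (sym lr)) ⟩
    k + norm ((p ⊕ p′) ++ (r ⊕ r′) ++ (s ⊕ s′))              ≡⟨ cong (k +_) (norm-++-++ (p ⊕ p′) (r ⊕ r′) (s ⊕ s′)) ⟩
    k + (norm (p ⊕ p′) + (norm (r ⊕ r′) + norm (s ⊕ s′)))    ≡⟨ regroup k (norm (p ⊕ p′)) (norm (r ⊕ r′)) (norm (s ⊕ s′)) ⟩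
    norm (r ⊕ r′) + (k + (norm (p ⊕ p′) + norm (s ⊕ s′)))    <⟨ ℕ.+-mono-≤-< light base-drop ⟩
    norm r + (norm p + norm s)                               ≡⟨ x∙yz≈y∙xz (norm r) (norm p) (norm s) ⟩
    norm p + (norm r + norm s)                               ≡⟨ norm-++-++ p r s ⟨
    norm (p ++ r ++ s)                                       ∎
    where
    regroup : ∀ k a m b → k + (a + (m + b)) ≡ m + (k + (a + b))
    regroup = ℕ-Solver.solve-∀

cancels-pump : ∀ p p′ q q′ s s′ {d l} →
               length p′ ≡ length p → length q′ ≡ length q → length s′ ≡ length s →
               val (q′ ++ s′ ∷ʳ l) ≡ val (s′ ∷ʳ l) → norm (q ⊕ q′) ≤ norm q →
               Cancels (p ++ s) d (p′ ++ s′) l → ∀ n → Cancels (p ++ rep n q ++ s) d (p′ ++ rep n q′ ++ s′) l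
cancels-pump p p′ q q′ s s′ lp lq ls period light c n =
  cancels-insert p p′ (rep n q) (rep n q′) s s′ lp (length-rep-cong lq n) ls
    (val-rep-++ q′ period n) (norm-rep-⊕-≤ (sym lq) light n) c

Cancellable : List ℤ → Set
Cancellable f = Σ ℤ λ d → Σ (List ℤ) λ M → Σ ℤ λ l → Cancels f d M l

periodic-cancellable :
  ∀ e q s d m l q′ s′ →
  {_ : True (length q′ ℕ.≟ length q)} {_ : True (length s′ ℕ.≟ length s)} →
  {_ : True (val (q′ ++ s′ ∷ʳ l) ≟β val (s′ ∷ʳ l))} {_ : True (norm (q ⊕ q′) ≤? norm q)} →
  {_ : True (val (d ∷ m ∷ s′ ∷ʳ l) ≟β 0β)} {_ : True (∣ d ∣ + ∣ l ∣ + norm ((e ∷ s) ⊕ (m ∷ s′)) <? norm (e ∷ s))} →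
  ∀ n → Cancellable (e ∷ rep n q ++ s)
periodic-cancellable e q s d m l q′ s′ {lq} {ls} {period} {light} {zero-value} {drop} n =
  d , m ∷ rep n q′ ++ s′ , l ,
  cancels-pump (e ∷ []) (m ∷ []) q q′ s s′ refl (toWitness lq) (toWitness ls) (toWitness period) (toWitness light)
    (cancels (toWitness zero-value) (cong suc (toWitness ls)) (toWitness drop)) n

-- Each row: f = e·qⁿ·s lies over the zero word d·m·q′ⁿ·s′·l.
H-cancellable : ∀ {f} → InH f → Cancellable f
H-cancellable (h1 n) = periodic-cancellable 1ℤ (0ℤ ∷ 1ℤ ∷ 0ℤ ∷ 0ℤ ∷ []) (1ℤ ∷ [])
                         1ℤ -1ℤ 0ℤ (0ℤ ∷ -1ℤ ∷ 0ℤ ∷ -1ℤ ∷ []) (-1ℤ ∷ []) n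
H-cancellable (h2 n) = periodic-cancellable 1ℤ (0ℤ ∷ 1ℤ ∷ 0ℤ ∷ 0ℤ ∷ []) (0ℤ ∷ 1ℤ ∷ 0ℤ ∷ 1ℤ ∷ [])
                         1ℤ -1ℤ -1ℤ (0ℤ ∷ -1ℤ ∷ 0ℤ ∷ -1ℤ ∷ []) (0ℤ ∷ -1ℤ ∷ 0ℤ ∷ -1ℤ ∷ []) n
H-cancellable (h3 n) = periodic-cancellable 1ℤ (0ℤ ∷ 0ℤ ∷ -1ℤ ∷ 0ℤ ∷ []) (-1ℤ ∷ [])
                         0ℤ -1ℤ 1ℤ (1ℤ ∷ 0ℤ ∷ 1ℤ ∷ 0ℤ ∷ []) (1ℤ ∷ []) n
H-cancellable (h4 n) = periodic-cancellable 1ℤ (0ℤ ∷ 0ℤ ∷ -1ℤ ∷ 0ℤ ∷ []) (0ℤ ∷ -1ℤ ∷ [])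
                         0ℤ -1ℤ 0ℤ (1ℤ ∷ 0ℤ ∷ 1ℤ ∷ 0ℤ ∷ []) (1ℤ ∷ 1ℤ ∷ []) n
H-cancellable (h5 n) = periodic-cancellable -1ℤ (0ℤ ∷ -1ℤ ∷ 0ℤ ∷ 0ℤ ∷ []) (-1ℤ ∷ [])
                         -1ℤ 1ℤ 0ℤ (0ℤ ∷ 1ℤ ∷ 0ℤ ∷ 1ℤ ∷ []) (1ℤ ∷ []) n
H-cancellable (h6 n) = periodic-cancellable -1ℤ (0ℤ ∷ -1ℤ ∷ 0ℤ ∷ 0ℤ ∷ []) (0ℤ ∷ -1ℤ ∷ 0ℤ ∷ -1ℤ ∷ [])
                         -1ℤ 1ℤ 1ℤ (0ℤ ∷ 1ℤ ∷ 0ℤ ∷ 1ℤ ∷ []) (0ℤ ∷ 1ℤ ∷ 0ℤ ∷ 1ℤ ∷ []) n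
H-cancellable (h7 n) = periodic-cancellable -1ℤ (0ℤ ∷ 0ℤ ∷ 1ℤ ∷ 0ℤ ∷ []) (1ℤ ∷ [])
                         0ℤ 1ℤ -1ℤ (-1ℤ ∷ 0ℤ ∷ -1ℤ ∷ 0ℤ ∷ []) (-1ℤ ∷ []) n
H-cancellable (h8 n) = periodic-cancellable -1ℤ (0ℤ ∷ 0ℤ ∷ 1ℤ ∷ 0ℤ ∷ []) (0ℤ ∷ 1ℤ ∷ [])
                         0ℤ 1ℤ 0ℤ (-1ℤ ∷ 0ℤ ∷ -1ℤ ∷ 0ℤ ∷ []) (-1ℤ ∷ -1ℤ ∷ []) n

-- The cancellation argument works for words over all of ℤ.
mainTheorem6 : (x : List ℤ) → All IsDigit x → (Σ (List ℤ) λ f → InH f × Factor f x) → Heavy x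
mainTheorem6 x _ (f , f∈H , u , v , refl) with H-cancellable f∈H
... | d , M , l , c = cancels⇒heavy c u v
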